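{- If $\vdash_{\mathsf{GT}} \Gamma\Rightarrow \Delta$, then for each pair of partitions $\Gamma_1 ,\Gamma_2$ of $\Gamma$ and $\Lambda_1 ,\Delta_2$ of $\Delta$ with $\Lambda_1$ consisting of classical formulas, there is a sequent interpolant $\phi$ of $\Gamma_1 ;\Gamma_2\Rightarrow \Lambda_1 ;\Delta_2$, and if $\Delta_2$ is classical, then $\phi$ is classical.
   Context: Classical formulas: $\alpha::=p\mid\bot\mid\neg\alpha\mid\alpha\wedge\alpha\mid\alpha\vee\alpha$; formulas of $\mathbf{PL}(\mathbin{\backslash\!\!\!/})$: $\phi::=\alpha\mid\phi\wedge\phi\mid\phi\vee\phi\mid\phi\mathbin{\backslash\!\!\!/}\phi$ ($\vee$ split disjunction, $\mathbin{\backslash\!\!\!/}$ inquisitive disjunction). $\mathsf{GT}$ ($\alpha$ classical, $\Lambda$ a multiset of classical formulas) has axioms $\Gamma,p\Rightarrow p,\Delta$, $\Gamma,\bot\Rightarrow\Delta$ and rules $\mathsf{L}\neg$ ($\Gamma\Rightarrow\alpha,\Delta$ / $\Gamma,\neg\alpha\Rightarrow\Delta$), $\mathsf{R}\neg$ ($\Gamma,\alpha\Rightarrow\Delta$ / $\Gamma\Rightarrow\neg\alpha,\Delta$), $\mathsf{L}\wedge$ ($\Gamma,\phi,\psi\Rightarrow\Delta$ / $\Gamma,\phi\wedge\psi\Rightarrow\Delta$), $\mathsf{R}\wedge$ ($\Gamma\Rightarrow\phi,\Lambda$ and $\Gamma\Rightarrow\psi,\Lambda$ / $\Gamma\Rightarrow\phi\wedge\psi,\Lambda,\Delta$),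 $\mathsf{L}\vee$ ($\Gamma,\phi\Rightarrow\Lambda$ and $\Gamma,\psi\Rightarrow\Lambda$ / $\Gamma,\phi\vee\psi\Rightarrow\Lambda,\Delta$), $\mathsf{R}\vee$ ($\Gamma\Rightarrow\phi,\psi,\Delta$ / $\Gamma\Rightarrow\phi\vee\psi,\Delta$), $\mathsf{L}\mathbin{\backslash\!\!\!/}$ ($\Gamma,\chi\{\phi_L\}\Rightarrow\Delta$ and $\Gamma,\chi\{\phi_R\}\Rightarrow\Delta$ / $\Gamma,\chi\{\phi_L\mathbin{\backslash\!\!\!/}\phi_R\}\Rightarrow\Delta$), $\mathsf{R}\mathbin{\backslash\!\!\!/}$ ($\Gamma\Rightarrow\chi\{\phi_i\},\Delta$ / $\Gamma\Rightarrow\chi\{\phi_L\mathbin{\backslash\!\!\!/}\phi_R\},\Delta$), and $\mathsf{Cut}$ ($\Gamma\Rightarrow\phi,\Delta$ and $\Pi,\phi\Rightarrow\Sigma$ / $\Pi,\Gamma\Rightarrow\Delta,\Sigma$), where $\chi\{\eta\}$ replaces a fixed subformula occurrence of $\chi$ not in the scope of a negation by $\eta$; $\mathsf{GT}^-$ is $\mathsf{GT}$ without $\mathsf{Cut}$. An occurrence of a propositional variable is positive/negative in $\phi$ if it lies in the scope of an even/odd number of $\neg$; $\mathsf{P}^+(\phi)$, $\mathsf{P}^-(\phi)$ are the sets of variables occurring positively/negatively, extended to multisets by union. A partition sequent is $\Gamma_1;\Gamma_2\Rightarrow\Delta_1;\Delta_2$ where $\Gamma_1,\Gamma_2\Rightarrow\Delta_1,\Delta_2$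 is a sequent. A formula $\phi$ is a sequent interpolant of it if (i) $\vdash_{\mathsf{GT}^- }\Gamma_1\Rightarrow\Delta_1,\phi$ and $\vdash_{\mathsf{GT}^- }\Gamma_2,\phi\Rightarrow\Delta_2$, and (ii) $\mathsf{P}^i(\phi)\subseteq(\mathsf{P}^i(\Gamma_1)\cup\mathsf{P}^j(\Delta_1))\cap(\mathsf{P}^j(\Gamma_2)\cup\mathsf{P}^i(\Delta_2))$ for $i\in\{+,-\}$ and $j$ the other sign. -}

module Defs where

open import Data.Nat using (ℕ)
open import Data.List using (List; []; _∷_; _++_)
open import Data.List.Relation.Unary.All using (All)
open import Data.List.Relation.Unary.Any using (Any)
open import Data.List.Relation.Binary.Permutation.Propositional using (_↭_)
open import Data.Product using (_×_)
open import Data.Sum using (_⊎_)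
open import Relation.Binary.PropositionalEquality using (_≡_)

-- Formulas of PL(⩔).  Propositional variables are natural numbers.
--   ∨ : split (tensor) disjunction,   ⩔ : inquisitive disjunction.

infixr 8 _∧_
infixr 7 _∨_ _⩔_

data Fm : Set where
  var : ℕ → Fm
  ⊥'  : Fm
  ¬'  : Fm → Fm
  _∧_ : Fm → Fm → Fm
  _∨_ : Fm → Fm → Fm
  _⩔_ : Fm → Fm → Fm

data Classical : Fm → Set where
  var : ∀ p → Classical (var p)
  bot : Classical ⊥'
  neg : ∀ {a} → Classical a → Classical (¬' a)
  and : ∀ {a b} → Classical a → Classical b → Classical (a ∧ b)
  or  : ∀ {a b} → Classical a → Classical b → Classical (a ∨ b)

data WF : Fm → Set where
  cl  : ∀ {a} → Classical a → WF a
  and : ∀ {a b} → WF a → WF b → WF (a ∧ b)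
  or  : ∀ {a b} → WF a → WF b → WF (a ∨ b)
  ior : ∀ {a b} → WF a → WF b → WF (a ⩔ b)

-- Contexts χ{·}: a formula with one hole NOT in the scope of a negation
-- (there is no negation constructor on the path to the hole).

data Ctx : Set where
  ∙    : Ctx
  ∧ˡ   : Ctx → Fm → Ctx
  ∧ʳ   : Fm → Ctx → Ctx
  ∨ˡ   : Ctx → Fm → Ctx
  ∨ʳ   : Fm → Ctx → Ctx
  ⩔ˡ   : Ctx → Fm → Ctx
  ⩔ʳ   : Fm → Ctx → Ctx

plug : Ctx → Fm → Fm
plug ∙        η = η
plug (∧ˡ C b) η = plug C η ∧ b
plug (∧ʳ a C) η = a ∧ plug C η
plug (∨ˡ C b) η = plug C η ∨ b
plug (∨ʳ a C) η = a ∨ plug C η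
plug (⩔ˡ C b) η = plug C η ⩔ b
plug (⩔ʳ a C) η = a ⩔ plug C η

-- Sequents Γ ⇒ Δ are pairs of lists read as multisets: the rule `perm`
-- closes derivability under permutation of either side.
-- "Γ, φ" is written φ ∷ Γ.

data Calc : Set where
  GT GT⁻ : Calc

infix 2 _⊢_⇒_
data _⊢_⇒_ (S : Calc) : List Fm → List Fm → Set where
  perm : ∀ {Γ Γ' Δ Δ'} → Γ ↭ Γ' → Δ ↭ Δ' → S ⊢ Γ ⇒ Δ → S ⊢ Γ' ⇒ Δ'
  ax   : ∀ {Γ Δ} p → S ⊢ var p ∷ Γ ⇒ var p ∷ Δ
  ax⊥  : ∀ {Γ Δ} → S ⊢ ⊥' ∷ Γ ⇒ Δ
  L¬   : ∀ {Γ Δ a} → Classical a → S ⊢ Γ ⇒ a ∷ Δ → S ⊢ ¬' a ∷ Γ ⇒ Δ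
  R¬   : ∀ {Γ Δ a} → Classical a → S ⊢ a ∷ Γ ⇒ Δ → S ⊢ Γ ⇒ ¬' a ∷ Δ
  L∧   : ∀ {Γ Δ φ ψ} → S ⊢ φ ∷ ψ ∷ Γ ⇒ Δ → S ⊢ φ ∧ ψ ∷ Γ ⇒ Δ
  R∧   : ∀ {Γ Λ Δ φ ψ} → All Classical Λ →
         S ⊢ Γ ⇒ φ ∷ Λ → S ⊢ Γ ⇒ ψ ∷ Λ → S ⊢ Γ ⇒ (φ ∧ ψ) ∷ Λ ++ Δ
  L∨   : ∀ {Γ Λ Δ φ ψ} → All Classical Λ →
         S ⊢ φ ∷ Γ ⇒ Λ → S ⊢ ψ ∷ Γ ⇒ Λ → S ⊢ φ ∨ ψ ∷ Γ ⇒ Λ ++ Δ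
  R∨   : ∀ {Γ Δ φ ψ} → S ⊢ Γ ⇒ φ ∷ ψ ∷ Δ → S ⊢ Γ ⇒ φ ∨ ψ ∷ Δ
  L⩔   : ∀ {Γ Δ} (χ : Ctx) {φL φR} →
         S ⊢ plug χ φL ∷ Γ ⇒ Δ → S ⊢ plug χ φR ∷ Γ ⇒ Δ →
         S ⊢ plug χ (φL ⩔ φR) ∷ Γ ⇒ Δ
  R⩔ˡ  : ∀ {Γ Δ} (χ : Ctx) {φL φR} →
         S ⊢ Γ ⇒ plug χ φL ∷ Δ → S ⊢ Γ ⇒ plug χ (φL ⩔ φR) ∷ Δ
  R⩔ʳ  : ∀ {Γ Δ} (χ : Ctx) {φL φR} →
         S ⊢ Γ ⇒ plug χ φR ∷ Δ → S ⊢ Γ ⇒ plug χ (φL ⩔ φR) ∷ Δ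
  cut  : ∀ {Γ Δ Π Σ φ} → S ≡ GT →
         S ⊢ Γ ⇒ φ ∷ Δ → S ⊢ φ ∷ Π ⇒ Σ → S ⊢ Π ++ Γ ⇒ Δ ++ Σ

data Sign : Set where
  + - : Sign

flip : Sign → Sign
flip + = -
flip - = +

data Occ : Sign → ℕ → Fm → Set where
  here : ∀ p → Occ + p (var p)
  neg  : ∀ {s p a} → Occ (flip s) p a → Occ s p (¬' a)
  ∧₁   : ∀ {s p a b} → Occ s p a → Occ s p (a ∧ b)
  ∧₂   : ∀ {s p a b} → Occ s p b → Occ s p (a ∧ b)
  ∨₁   : ∀ {s p a b} → Occ s p a → Occ s p (a ∨ b)
  ∨₂   : ∀ {s p a b} → Occ s p b → Occ s p (a ∨ b)
  ⩔₁   : ∀ {s p a b} → Occ s p a → Occ s p (a ⩔ b)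
  ⩔₂   : ∀ {s p a b} → Occ s p b → Occ s p (a ⩔ b)

OccL : Sign → ℕ → List Fm → Set
OccL s p Γ = Any (Occ s p) Γ

record Interpolant (Γ₁ Γ₂ Δ₁ Δ₂ : List Fm) (φ : Fm) : Set where
  field
    left  : GT⁻ ⊢ Γ₁ ⇒ Δ₁ ++ (φ ∷ [])
    right : GT⁻ ⊢ φ ∷ Γ₂ ⇒ Δ₂
    vars  : ∀ (i : Sign) (p : ℕ) → Occ i p φ →
            (OccL i p Γ₁ ⊎ OccL (flip i) p Δ₁) ×
            (OccL (flip i) p Γ₂ ⊎ OccL i p Δ₂)

{-# OPTIONS --safe #-}
-- Cut is eliminated semantically.  A resolution of a formula chooses one disjunct of every ⩔
-- outside the scope of ¬, and GT is sound for the reading of Γ ⇒ Δ as "for all resolutions of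
-- Γ there are resolutions of Δ giving a classically valid sequent".  Conversely L⩔ and R⩔
-- reduce a valid sequent of well-formed formulas to resolved classical sequents, which
-- invertible proof search derives without cut.
--
-- Interpolants are then built by Maehara's method, by induction on the cut-free derivation
-- simultaneously for all partitions: the interpolants of the premises are joined by ∨ when the
-- principal formula lies in Γ₁ ⇒ Λ₁ and by ∧ when it lies in Γ₂ ⇒ Δ₂.  The new derivations
-- apply R∧ and L∨ only over classical contexts, which is why Λ₁ must be classical.  Only an L⩔
-- in Γ₁ with non-classical Δ₂ calls for the inquisitive interpolant θ₁ ⩔ θ₂, since there L∨
-- cannot join the right derivations.

module Submission where

open import Defs
open import Data.Bool using (Bool; T)
open import Data.Empty using (⊥; ⊥-elim)
open import Data.List using (List; []; _∷_; _++_; [_]; map)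
open import Data.List.Properties using (++-assoc; ++-identityʳ)
open import Data.List.Membership.Propositional using (_∈_; find)
open import Data.List.Membership.Propositional.Properties using (∈-∃++; ∈-++⁻; ∈-map⁺)
open import Data.List.Relation.Binary.Pointwise as Pointwise using (Pointwise; []; _∷_)
open import Data.List.Relation.Binary.Permutation.Propositional
  using (_↭_; refl; prep; swap; trans; ↭-sym)
open import Data.List.Relation.Binary.Permutation.Propositional.Properties
  using (All-resp-↭; Any-resp-↭; ∈-resp-↭; shift; shifts; drop-∷; ++⁺ˡ; ++⁺ʳ; ++-comm)
open import Data.List.Relation.Unary.All as All using (All; []; _∷_; all?)
import Data.List.Relation.Unary.All.Properties as AllP
open import Data.List.Relation.Unary.Any as Any using (Any; here; there)
import Data.List.Relation.Unary.Any.Properties as AnyP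
open import Data.Nat using (ℕ; zero; suc; _<_; _≤_; s≤s; _≟_)
open import Data.List.Membership.DecPropositional _≟_ using (_∈?_)
open import Data.Nat.Properties using (≤-refl; ≤-trans; m≤n⇒m≤1+n)
open import Data.Product using (Σ; ∃; ∃₂; ∃-syntax; _×_; _,_; proj₁; proj₂)
import Data.Product as Product
open import Data.Sum using (_⊎_; inj₁; inj₂)
import Data.Sum as Sum
open import Function using (id; _∘_)
open import Relation.Binary.PropositionalEquality using (_≡_; refl; sym; subst; subst₂; cong; cong₂)
open import Relation.Nullary using (¬_; Dec; yes; no)
open import Relation.Nullary.Decidable using (T?; ¬?; _×-dec_; _⊎-dec_; ⌊_⌋; fromWitness; toWitness)

module _ {a} {A : Set a} where

  ∈⇒↭∷ : ∀ {x : A} {xs} → x ∈ xs → ∃ λ ys → xs ↭ x ∷ ys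
  ∈⇒↭∷ x∈xs with ys , zs , refl ← ∈-∃++ x∈xs = ys ++ zs , shift _ ys zs

  data Located (x : A) (xs ys zs : List A) : Set a where
    in₁ : ∀ {ys'} → x ∷ ys' ↭ ys → xs ↭ ys' ++ zs → Located x xs ys zs
    in₂ : ∀ {zs'} → x ∷ zs' ↭ zs → xs ↭ ys ++ zs' → Located x xs ys zs

  locate : ∀ {x xs} ys zs → x ∷ xs ↭ ys ++ zs → Located x xs ys zs
  locate {x} ys zs p with ∈-++⁻ ys (∈-resp-↭ p (here refl))
  ... | inj₁ x∈ys with ys' , q ← ∈⇒↭∷ x∈ys =
    in₁ (↭-sym q) (drop-∷ (trans p (++⁺ʳ zs q)))
  ... | inj₂ x∈zs with zs' , q ← ∈⇒↭∷ x∈zs =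
    in₂ (↭-sym q) (drop-∷ (trans p (trans (++⁺ˡ ys q) (shift x ys zs'))))

  insert₂ : ∀ ws {xs ys zs : List A} → xs ↭ ys ++ zs → ws ++ xs ↭ ys ++ ws ++ zs
  insert₂ ws {ys = ys} p = trans (++⁺ˡ ws p) (shifts ws ys)

  record Refinement (xs ys us vs : List A) : Set a where
    constructor refinement
    field
      {xu xv yu yv} : List A
      xs↭ : xs ↭ xu ++ xv
      ys↭ : ys ↭ yu ++ yv
      us↭ : us ↭ xu ++ yu
      vs↭ : vs ↭ xv ++ yv

  refine : ∀ xs {ys} us vs → xs ++ ys ↭ us ++ vs → Refinement xs ys us vs
  refine []       us vs p = refinement {xu = []} {xv = []} refl p refl refl
  refine (x ∷ xs) us vs p with locate us vs p
  ... | in₁ q p' with refinement {xu} {xv} xs↭ ys↭ us↭ vs↭ ← refine xs _ vs p' =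
    refinement {xu = x ∷ xu} {xv = xv} (prep x xs↭) ys↭ (trans (↭-sym q) (prep x us↭)) vs↭
  ... | in₂ q p' with refinement {xu} {xv} xs↭ ys↭ us↭ vs↭ ← refine xs us _ p' =
    refinement {xu = xu} {xv = x ∷ xv} (trans (prep x xs↭) (↭-sym (shift x xu xv))) ys↭ us↭
      (trans (↭-sym q) (prep x vs↭))

  All-++⁻-↭ : ∀ {p} {P : A → Set p} xs {ys zs} → zs ↭ xs ++ ys → All P zs → All P xs × All P ys
  All-++⁻-↭ xs p = AllP.++⁻ xs ∘ All-resp-↭ p

module _ {a b r} {A : Set a} {B : Set b} {R : A → B → Set r} where

  Pointwise-↭ : ∀ {xs ys xs'} → xs ↭ ys → Pointwise R xs xs' →
                ∃[ ys' ] Pointwise R ys ys' × xs' ↭ ys'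
  Pointwise-↭ refl rs = _ , rs , refl
  Pointwise-↭ (prep x p) (r ∷ rs) with _ , rs' , q ← Pointwise-↭ p rs = _ , r ∷ rs' , prep _ q
  Pointwise-↭ (swap x y p) (r ∷ s ∷ rs) with _ , rs' , q ← Pointwise-↭ p rs =
    _ , s ∷ r ∷ rs' , swap _ _ q
  Pointwise-↭ (trans p q) rs
    with _ , rs' , p' ← Pointwise-↭ p rs
    with _ , rs'' , q' ← Pointwise-↭ q rs' = _ , rs'' , trans p' q'

  Pointwise-++⁻ : ∀ xs {ys zs} → Pointwise R (xs ++ ys) zs →
                  ∃₂ λ xs' ys' → zs ≡ xs' ++ ys' × Pointwise R xs xs' × Pointwise R ys ys'
  Pointwise-++⁻ []       rs = [] , _ , refl , [] , rs
  Pointwise-++⁻ (x ∷ xs) (r ∷ rs) with _ , _ , refl , rxs , rys ← Pointwise-++⁻ xs rs =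
    _ , _ , refl , r ∷ rxs , rys

private
  variable
    S : Calc
    Γ Γ' Δ Δ' Π Ξ Λ Γ₁ Γ₂ Λ₁ Δ₂ Γ₁' Γ₂' Λ₁' Δ₂' : List Fm
    φ ψ a b : Fm

swapˡ : S ⊢ φ ∷ ψ ∷ Γ ⇒ Δ → S ⊢ ψ ∷ φ ∷ Γ ⇒ Δ
swapˡ = perm (swap _ _ refl) refl

swapʳ : S ⊢ Γ ⇒ φ ∷ ψ ∷ Δ → S ⊢ Γ ⇒ ψ ∷ φ ∷ Δ
swapʳ = perm refl (swap _ _ refl)

weakenˡ : ∀ Γ' → S ⊢ Γ ⇒ Δ → S ⊢ Γ ++ Γ' ⇒ Δ
weakenˡ Γ' (perm p q d)          = perm (++⁺ʳ Γ' p) q (weakenˡ Γ' d)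
weakenˡ Γ' (ax p)                = ax p
weakenˡ Γ' ax⊥                   = ax⊥
weakenˡ Γ' (L¬ c d)              = L¬ c (weakenˡ Γ' d)
weakenˡ Γ' (R¬ c d)              = R¬ c (weakenˡ Γ' d)
weakenˡ Γ' (L∧ d)                = L∧ (weakenˡ Γ' d)
weakenˡ Γ' (R∧ c d e)            = R∧ c (weakenˡ Γ' d) (weakenˡ Γ' e)
weakenˡ Γ' (L∨ c d e)            = L∨ c (weakenˡ Γ' d) (weakenˡ Γ' e)
weakenˡ Γ' (R∨ d)                = R∨ (weakenˡ Γ' d)
weakenˡ Γ' (L⩔ χ d e)            = L⩔ χ (weakenˡ Γ' d) (weakenˡ Γ' e)
weakenˡ Γ' (R⩔ˡ χ d)             = R⩔ˡ χ (weakenˡ Γ' d)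
weakenˡ Γ' (R⩔ʳ χ d)             = R⩔ʳ χ (weakenˡ Γ' d)
weakenˡ Γ' (cut {Γ = Γ} {Π = Π} e d f) =
  subst (λ Θ → _ ⊢ Θ ⇒ _) (sym (++-assoc Π Γ Γ')) (cut e (weakenˡ Γ' d) f)

weakenʳ : ∀ Δ' → S ⊢ Γ ⇒ Δ → S ⊢ Γ ⇒ Δ ++ Δ'
weakenʳ Δ' (perm p q d)          = perm p (++⁺ʳ Δ' q) (weakenʳ Δ' d)
weakenʳ Δ' (ax p)                = ax p
weakenʳ Δ' ax⊥                   = ax⊥
weakenʳ Δ' (L¬ c d)              = L¬ c (weakenʳ Δ' d)
weakenʳ Δ' (R¬ c d)              = R¬ c (weakenʳ Δ' d)
weakenʳ Δ' (L∧ d)                = L∧ (weakenʳ Δ' d)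
weakenʳ Δ' (R∧ {Λ = Λ} {Δ = Δ} c d e) =
  subst (λ Θ → _ ⊢ _ ⇒ _ ∷ Θ) (sym (++-assoc Λ Δ Δ')) (R∧ c d e)
weakenʳ Δ' (L∨ {Λ = Λ} {Δ = Δ} c d e) =
  subst (λ Θ → _ ⊢ _ ⇒ Θ) (sym (++-assoc Λ Δ Δ')) (L∨ c d e)
weakenʳ Δ' (R∨ d)                = R∨ (weakenʳ Δ' d)
weakenʳ Δ' (L⩔ χ d e)            = L⩔ χ (weakenʳ Δ' d) (weakenʳ Δ' e)
weakenʳ Δ' (R⩔ˡ χ d)             = R⩔ˡ χ (weakenʳ Δ' d)
weakenʳ Δ' (R⩔ʳ χ d)             = R⩔ʳ χ (weakenʳ Δ' d)
weakenʳ Δ' (cut {Δ = Δ} {Σ = Ξ} e d f) =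
  subst (λ Θ → _ ⊢ _ ⇒ Θ) (sym (++-assoc Δ Ξ Δ')) (cut e d (weakenʳ Δ' f))

weaken-headˡ : ∀ φ → S ⊢ Γ ⇒ Δ → S ⊢ φ ∷ Γ ⇒ Δ
weaken-headˡ {Γ = Γ} φ d = perm (++-comm Γ [ φ ]) refl (weakenˡ [ φ ] d)

weaken-headʳ : ∀ φ → S ⊢ Γ ⇒ Δ → S ⊢ Γ ⇒ φ ∷ Δ
weaken-headʳ {Δ = Δ} φ d = perm refl (++-comm Δ [ φ ]) (weakenʳ [ φ ] d)

R∧′ : All Classical Λ → S ⊢ Γ ⇒ φ ∷ Λ → S ⊢ Γ ⇒ ψ ∷ Λ → S ⊢ Γ ⇒ φ ∧ ψ ∷ Λ
R∧′ {Λ = Λ} c d e = subst (λ Θ → _ ⊢ _ ⇒ _ ∷ Θ) (++-identityʳ Λ) (R∧ {Δ = []} c d e)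

L∨′ : All Classical Λ → S ⊢ φ ∷ Γ ⇒ Λ → S ⊢ ψ ∷ Γ ⇒ Λ → S ⊢ φ ∨ ψ ∷ Γ ⇒ Λ
L∨′ {Λ = Λ} c d e = subst (λ Θ → _ ⊢ _ ⇒ Θ) (++-identityʳ Λ) (L∨ {Δ = []} c d e)

∨-introˡ : S ⊢ Γ ⇒ φ ∷ Δ → S ⊢ Γ ⇒ φ ∨ ψ ∷ Δ
∨-introˡ {ψ = ψ} d = R∨ (swapʳ (weaken-headʳ ψ d))

∨-introʳ : S ⊢ Γ ⇒ ψ ∷ Δ → S ⊢ Γ ⇒ φ ∨ ψ ∷ Δ
∨-introʳ {φ = φ} d = R∨ (weaken-headʳ φ d)

∧-elimˡ : S ⊢ φ ∷ Γ ⇒ Δ → S ⊢ φ ∧ ψ ∷ Γ ⇒ Δ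
∧-elimˡ {ψ = ψ} d = L∧ (swapˡ (weaken-headˡ ψ d))

∧-elimʳ : S ⊢ ψ ∷ Γ ⇒ Δ → S ⊢ φ ∧ ψ ∷ Γ ⇒ Δ
∧-elimʳ {φ = φ} d = L∧ (weaken-headˡ φ d)

Occ-plug : ∀ χ {η η'} → (∀ {s p} → Occ s p η → Occ s p η') →
           ∀ {s p} → Occ s p (plug χ η) → Occ s p (plug χ η')
Occ-plug ∙        f o      = f o
Occ-plug (∧ˡ χ _) f (∧₁ o) = ∧₁ (Occ-plug χ f o)
Occ-plug (∧ˡ χ _) f (∧₂ o) = ∧₂ o
Occ-plug (∧ʳ _ χ) f (∧₁ o) = ∧₁ o
Occ-plug (∧ʳ _ χ) f (∧₂ o) = ∧₂ (Occ-plug χ f o)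
Occ-plug (∨ˡ χ _) f (∨₁ o) = ∨₁ (Occ-plug χ f o)
Occ-plug (∨ˡ χ _) f (∨₂ o) = ∨₂ o
Occ-plug (∨ʳ _ χ) f (∨₁ o) = ∨₁ o
Occ-plug (∨ʳ _ χ) f (∨₂ o) = ∨₂ (Occ-plug χ f o)
Occ-plug (⩔ˡ χ _) f (⩔₁ o) = ⩔₁ (Occ-plug χ f o)
Occ-plug (⩔ˡ χ _) f (⩔₂ o) = ⩔₂ o
Occ-plug (⩔ʳ _ χ) f (⩔₁ o) = ⩔₁ o
Occ-plug (⩔ʳ _ χ) f (⩔₂ o) = ⩔₂ (Occ-plug χ f o)

plug-⩔-nonclassical : ∀ χ → ¬ Classical (plug χ (φ ⩔ ψ))
plug-⩔-nonclassical ∙        ()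
plug-⩔-nonclassical (∧ˡ χ _) (and c _) = plug-⩔-nonclassical χ c
plug-⩔-nonclassical (∧ʳ _ χ) (and _ c) = plug-⩔-nonclassical χ c
plug-⩔-nonclassical (∨ˡ χ _) (or c _)  = plug-⩔-nonclassical χ c
plug-⩔-nonclassical (∨ʳ _ χ) (or _ c)  = plug-⩔-nonclassical χ c
plug-⩔-nonclassical (⩔ˡ χ _) ()
plug-⩔-nonclassical (⩔ʳ _ χ) ()

classical? : ∀ φ → Dec (Classical φ)
classical? (var p) = yes (var p)
classical? ⊥'      = yes bot
classical? (¬' a) with classical? a
... | yes c = yes (neg c)
... | no ¬c = no λ { (neg c) → ¬c c }
classical? (a ∧ b) with classical? a | classical? b
... | yes c | yes d = yes (and c d)
... | no ¬c | _     = no λ { (and c _) → ¬c c }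
... | _     | no ¬d = no λ { (and _ d) → ¬d d }
classical? (a ∨ b) with classical? a | classical? b
... | yes c | yes d = yes (or c d)
... | no ¬c | _     = no λ { (or c _) → ¬c c }
... | _     | no ¬d = no λ { (or _ d) → ¬d d }
classical? (a ⩔ b) = no λ ()

OccSeq : Sign → ℕ → List Fm → List Fm → Set
OccSeq s p Γ Δ = OccL s p Γ ⊎ OccL (flip s) p Δ

infix 4 _⊑_
_⊑_ : List Fm × List Fm → List Fm × List Fm → Set
(Γ , Δ) ⊑ (Γ' , Δ') = ∀ {s p} → OccSeq s p Γ Δ → OccSeq s p Γ' Δ'

⊑-refl : (Γ , Δ) ⊑ (Γ , Δ)
⊑-refl = id

⊑-↭ : Γ ↭ Γ' → Δ ↭ Δ' → (Γ , Δ) ⊑ (Γ' , Δ')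
⊑-↭ p q = Sum.map (Any-resp-↭ p) (Any-resp-↭ q)

⊑-++ʳ : ∀ Δ' → (Γ , Δ) ⊑ (Γ , Δ ++ Δ')
⊑-++ʳ _ = Sum.map id AnyP.++⁺ˡ

⊑-∷ˡ : (∀ {s p} → Occ s p φ → Occ s p ψ) → (φ ∷ Γ , Δ) ⊑ (ψ ∷ Γ , Δ)
⊑-∷ˡ f (inj₁ (here o))  = inj₁ (here (f o))
⊑-∷ˡ f (inj₁ (there o)) = inj₁ (there o)
⊑-∷ˡ f (inj₂ o)         = inj₂ o

⊑-∷ʳ : (∀ {s p} → Occ s p φ → Occ s p ψ) → (Γ , φ ∷ Δ) ⊑ (Γ , ψ ∷ Δ)
⊑-∷ʳ f (inj₁ o)         = inj₁ o
⊑-∷ʳ f (inj₂ (here o))  = inj₂ (here (f o))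
⊑-∷ʳ f (inj₂ (there o)) = inj₂ (there o)

⊑-L∧ : (φ ∷ ψ ∷ Γ , Δ) ⊑ (φ ∧ ψ ∷ Γ , Δ)
⊑-L∧ (inj₁ (here o))         = inj₁ (here (∧₁ o))
⊑-L∧ (inj₁ (there (here o))) = inj₁ (here (∧₂ o))
⊑-L∧ (inj₁ (there (there o))) = inj₁ (there o)
⊑-L∧ (inj₂ o)                = inj₂ o

⊑-R∨ : (Γ , φ ∷ ψ ∷ Δ) ⊑ (Γ , φ ∨ ψ ∷ Δ)
⊑-R∨ (inj₁ o)                 = inj₁ o
⊑-R∨ (inj₂ (here o))          = inj₂ (here (∨₁ o))
⊑-R∨ (inj₂ (there (here o)))  = inj₂ (here (∨₂ o))
⊑-R∨ (inj₂ (there (there o))) = inj₂ (there o)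

flip-involutive : ∀ s → flip (flip s) ≡ s
flip-involutive + = refl
flip-involutive - = refl

⊑-L¬ : (Γ , a ∷ Δ) ⊑ (¬' a ∷ Γ , Δ)
⊑-L¬ (inj₁ o)         = inj₁ (there o)
⊑-L¬ (inj₂ (here o))  = inj₁ (here (neg o))
⊑-L¬ (inj₂ (there o)) = inj₂ o

⊑-R¬ : (a ∷ Γ , Δ) ⊑ (Γ , ¬' a ∷ Δ)
⊑-R¬ {s = s} (inj₁ (here o)) =
  inj₂ (here (neg (subst (λ t → Occ t _ _) (sym (flip-involutive s)) o)))
⊑-R¬ (inj₁ (there o))        = inj₁ o
⊑-R¬ (inj₂ o)                = inj₂ (there o)

-- Maehara's method

-- The second component is OccSeq (flip i) p Γ₂ Δ₂, spelt out to agree definitionally with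
-- Interpolant.vars.
SharedVars : Fm → (Γ₁ Γ₂ Λ₁ Δ₂ : List Fm) → Set
SharedVars θ Γ₁ Γ₂ Λ₁ Δ₂ =
  ∀ i p → Occ i p θ → OccSeq i p Γ₁ Λ₁ × (OccL (flip i) p Γ₂ ⊎ OccL i p Δ₂)

shared-mono : ∀ {θ} → (Γ₁ , Λ₁) ⊑ (Γ₁' , Λ₁') → (Γ₂ , Δ₂) ⊑ (Γ₂' , Δ₂') →
              SharedVars θ Γ₁ Γ₂ Λ₁ Δ₂ → SharedVars θ Γ₁' Γ₂' Λ₁' Δ₂'
shared-mono h₁ h₂ sh + p o = Product.map h₁ h₂ (sh + p o)
shared-mono h₁ h₂ sh - p o = Product.map h₁ h₂ (sh - p o)

module _ {θ₁ θ₂} (sh₁ : SharedVars θ₁ Γ₁ Γ₂ Λ₁ Δ₂) (sh₂ : SharedVars θ₂ Γ₁ Γ₂ Λ₁ Δ₂) where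

  shared-∧ : SharedVars (θ₁ ∧ θ₂) Γ₁ Γ₂ Λ₁ Δ₂
  shared-∧ i p (∧₁ o) = sh₁ i p o
  shared-∧ i p (∧₂ o) = sh₂ i p o

  shared-∨ : SharedVars (θ₁ ∨ θ₂) Γ₁ Γ₂ Λ₁ Δ₂
  shared-∨ i p (∨₁ o) = sh₁ i p o
  shared-∨ i p (∨₂ o) = sh₂ i p o

  shared-⩔ : SharedVars (θ₁ ⩔ θ₂) Γ₁ Γ₂ Λ₁ Δ₂
  shared-⩔ i p (⩔₁ o) = sh₁ i p o
  shared-⩔ i p (⩔₂ o) = sh₂ i p o

record Interpolation (Γ₁ Γ₂ Λ₁ Δ₂ : List Fm) : Set where
  constructor interpolation
  field
    θ         : Fm
    wf        : WF θ
    left      : GT⁻ ⊢ Γ₁ ⇒ θ ∷ Λ₁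
    right     : GT⁻ ⊢ θ ∷ Γ₂ ⇒ Δ₂
    shared    : SharedVars θ Γ₁ Γ₂ Λ₁ Δ₂
    classical : All Classical Δ₂ → Classical θ

Interpolation-resp-↭ : Γ₁ ↭ Γ₁' → Γ₂ ↭ Γ₂' → Λ₁ ↭ Λ₁' → Δ₂ ↭ Δ₂' →
                       Interpolation Γ₁ Γ₂ Λ₁ Δ₂ → Interpolation Γ₁' Γ₂' Λ₁' Δ₂'
Interpolation-resp-↭ p₁ p₂ q₁ q₂ (interpolation θ w l r sh cθ) =
  interpolation θ w (perm p₁ (prep θ q₁) l) (perm (prep θ p₂) q₂ r)
    (shared-mono (⊑-↭ p₁ q₁) (⊑-↭ p₂ q₂) sh) (cθ ∘ All-resp-↭ (↭-sym q₂))

Interpolation-weaken : ∀ Λ₁' Δ₂' → Interpolation Γ₁ Γ₂ Λ₁ Δ₂ →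
                       Interpolation Γ₁ Γ₂ (Λ₁ ++ Λ₁') (Δ₂ ++ Δ₂')
Interpolation-weaken {Δ₂ = Δ₂} Λ₁' Δ₂' (interpolation θ w l r sh cθ) =
  interpolation θ w (weakenʳ Λ₁' l) (weakenʳ Δ₂' r)
    (shared-mono (⊑-++ʳ Λ₁') (⊑-++ʳ Δ₂') sh) (cθ ∘ AllP.++⁻ˡ Δ₂)

⊤' : Fm
⊤' = ¬' ⊥'

interpolation-⊥ : GT⁻ ⊢ Γ₁ ⇒ Λ₁ → Interpolation Γ₁ Γ₂ Λ₁ Δ₂
interpolation-⊥ d = interpolation ⊥' (cl bot) (weaken-headʳ ⊥' d) ax⊥ (λ _ _ ()) (λ _ → bot)

interpolation-⊤ : GT⁻ ⊢ Γ₂ ⇒ Δ₂ → Interpolation Γ₁ Γ₂ Λ₁ Δ₂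
interpolation-⊤ d =
  interpolation ⊤' (cl (neg bot)) (R¬ bot ax⊥) (weaken-headˡ ⊤' d)
    (λ { _ _ (neg ()) }) (λ _ → neg bot)

-- Subscripts name the part of the partition holding the principal formula (antecedent first).
ax₁₂ : ∀ p → Interpolation (var p ∷ Γ₁) Γ₂ Λ₁ (var p ∷ Δ₂)
ax₁₂ p = interpolation (var p) (cl (var p)) (ax p) (ax p)
  (λ { _ _ (here _) → inj₁ (here (here p)) , inj₂ (here (here p)) }) (λ _ → var p)

ax₂₁ : ∀ p → Interpolation Γ₁ (var p ∷ Γ₂) (var p ∷ Λ₁) Δ₂
ax₂₁ p = interpolation (¬' (var p)) (cl (neg (var p))) (R¬ (var p) (ax p)) (L¬ (var p) (ax p))
  (λ { - _ (neg (here _)) → inj₂ (here (here p)) , inj₁ (here (here p)) ; + _ (neg ()) })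
  (λ _ → neg (var p))

L¬₁ : Classical a → Interpolation Γ₁ Γ₂ (a ∷ Λ₁) Δ₂ → Interpolation (¬' a ∷ Γ₁) Γ₂ Λ₁ Δ₂
L¬₁ c (interpolation θ w l r sh cθ) =
  interpolation θ w (L¬ c (swapʳ l)) r (shared-mono ⊑-L¬ ⊑-refl sh) cθ

L¬₂ : Classical a → Interpolation Γ₁ Γ₂ Λ₁ (a ∷ Δ₂) → Interpolation Γ₁ (¬' a ∷ Γ₂) Λ₁ Δ₂
L¬₂ c (interpolation θ w l r sh cθ) =
  interpolation θ w l (swapˡ (L¬ c r)) (shared-mono ⊑-refl ⊑-L¬ sh) (cθ ∘ (c ∷_))

R¬₁ : Classical a → Interpolation (a ∷ Γ₁) Γ₂ Λ₁ Δ₂ → Interpolation Γ₁ Γ₂ (¬' a ∷ Λ₁) Δ₂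
R¬₁ c (interpolation θ w l r sh cθ) =
  interpolation θ w (swapʳ (R¬ c l)) r (shared-mono ⊑-R¬ ⊑-refl sh) cθ

R¬₂ : Classical a → Interpolation Γ₁ (a ∷ Γ₂) Λ₁ Δ₂ → Interpolation Γ₁ Γ₂ Λ₁ (¬' a ∷ Δ₂)
R¬₂ c (interpolation θ w l r sh cθ) =
  interpolation θ w l (R¬ c (swapˡ r)) (shared-mono ⊑-refl ⊑-R¬ sh) (cθ ∘ All.tail)

L∧₁ : Interpolation (φ ∷ ψ ∷ Γ₁) Γ₂ Λ₁ Δ₂ → Interpolation (φ ∧ ψ ∷ Γ₁) Γ₂ Λ₁ Δ₂
L∧₁ (interpolation θ w l r sh cθ) = interpolation θ w (L∧ l) r (shared-mono ⊑-L∧ ⊑-refl sh) cθ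

L∧₂ : Interpolation Γ₁ (φ ∷ ψ ∷ Γ₂) Λ₁ Δ₂ → Interpolation Γ₁ (φ ∧ ψ ∷ Γ₂) Λ₁ Δ₂
L∧₂ {φ = φ} {ψ = ψ} (interpolation θ w l r sh cθ) =
  interpolation θ w l (swapˡ (L∧ (perm (shifts [ θ ] (φ ∷ ψ ∷ [])) refl r)))
    (shared-mono ⊑-refl ⊑-L∧ sh) cθ

R∨₁ : Interpolation Γ₁ Γ₂ (φ ∷ ψ ∷ Λ₁) Δ₂ → Interpolation Γ₁ Γ₂ (φ ∨ ψ ∷ Λ₁) Δ₂
R∨₁ {φ = φ} {ψ = ψ} (interpolation θ w l r sh cθ) =
  interpolation θ w (swapʳ (R∨ (perm refl (shifts [ θ ] (φ ∷ ψ ∷ [])) l))) r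
    (shared-mono ⊑-R∨ ⊑-refl sh) cθ

R∨₂ : Interpolation Γ₁ Γ₂ Λ₁ (φ ∷ ψ ∷ Δ₂) → Interpolation Γ₁ Γ₂ Λ₁ (φ ∨ ψ ∷ Δ₂)
R∨₂ (interpolation θ w l r sh cθ) =
  interpolation θ w l (R∨ r) (shared-mono ⊑-refl ⊑-R∨ sh) λ { (or cφ cψ ∷ c) → cθ (cφ ∷ cψ ∷ c) }

R⩔ˡ₂ : ∀ χ {φL φR} → Interpolation Γ₁ Γ₂ Λ₁ (plug χ φL ∷ Δ₂) →
       Interpolation Γ₁ Γ₂ Λ₁ (plug χ (φL ⩔ φR) ∷ Δ₂)
R⩔ˡ₂ χ (interpolation θ w l r sh cθ) =
  interpolation θ w l (R⩔ˡ χ r) (shared-mono ⊑-refl (⊑-∷ʳ (Occ-plug χ ⩔₁)) sh)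
    (⊥-elim ∘ plug-⩔-nonclassical χ ∘ All.head)

R⩔ʳ₂ : ∀ χ {φL φR} → Interpolation Γ₁ Γ₂ Λ₁ (plug χ φR ∷ Δ₂) →
       Interpolation Γ₁ Γ₂ Λ₁ (plug χ (φL ⩔ φR) ∷ Δ₂)
R⩔ʳ₂ χ (interpolation θ w l r sh cθ) =
  interpolation θ w l (R⩔ʳ χ r) (shared-mono ⊑-refl (⊑-∷ʳ (Occ-plug χ ⩔₂)) sh)
    (⊥-elim ∘ plug-⩔-nonclassical χ ∘ All.head)

module _ (cΛ₁ : All Classical Λ₁) (cΔ₂ : All Classical Δ₂) where

  R∧₁ : Interpolation Γ₁ Γ₂ (φ ∷ Λ₁) Δ₂ → Interpolation Γ₁ Γ₂ (ψ ∷ Λ₁) Δ₂ →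
        Interpolation Γ₁ Γ₂ (φ ∧ ψ ∷ Λ₁) Δ₂
  R∧₁ (interpolation θ₁ w₁ l₁ r₁ sh₁ cθ₁) (interpolation θ₂ w₂ l₂ r₂ sh₂ cθ₂) =
    interpolation (θ₁ ∨ θ₂) (or w₁ w₂)
      (swapʳ (R∧′ (or (cθ₁ cΔ₂) (cθ₂ cΔ₂) ∷ cΛ₁) (swapʳ (∨-introˡ l₁)) (swapʳ (∨-introʳ l₂))))
      (L∨′ cΔ₂ r₁ r₂)
      (shared-∨ (shared-mono (⊑-∷ʳ ∧₁) ⊑-refl sh₁) (shared-mono (⊑-∷ʳ ∧₂) ⊑-refl sh₂))
      (λ _ → or (cθ₁ cΔ₂) (cθ₂ cΔ₂))

  R∧₂ : Interpolation Γ₁ Γ₂ Λ₁ (φ ∷ Δ₂) → Interpolation Γ₁ Γ₂ Λ₁ (ψ ∷ Δ₂) →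
        Interpolation Γ₁ Γ₂ Λ₁ (φ ∧ ψ ∷ Δ₂)
  R∧₂ (interpolation θ₁ w₁ l₁ r₁ sh₁ cθ₁) (interpolation θ₂ w₂ l₂ r₂ sh₂ cθ₂) =
    interpolation (θ₁ ∧ θ₂) (and w₁ w₂) (R∧′ cΛ₁ l₁ l₂) (R∧′ cΔ₂ (∧-elimˡ r₁) (∧-elimʳ r₂))
      (shared-∧ (shared-mono ⊑-refl (⊑-∷ʳ ∧₁) sh₁) (shared-mono ⊑-refl (⊑-∷ʳ ∧₂) sh₂))
      (λ { (and cφ cψ ∷ c) → and (cθ₁ (cφ ∷ c)) (cθ₂ (cψ ∷ c)) })

  L∨₁ : Interpolation (φ ∷ Γ₁) Γ₂ Λ₁ Δ₂ → Interpolation (ψ ∷ Γ₁) Γ₂ Λ₁ Δ₂ →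
        Interpolation (φ ∨ ψ ∷ Γ₁) Γ₂ Λ₁ Δ₂
  L∨₁ (interpolation θ₁ w₁ l₁ r₁ sh₁ cθ₁) (interpolation θ₂ w₂ l₂ r₂ sh₂ cθ₂) =
    interpolation (θ₁ ∨ θ₂) (or w₁ w₂)
      (L∨′ (or (cθ₁ cΔ₂) (cθ₂ cΔ₂) ∷ cΛ₁) (∨-introˡ l₁) (∨-introʳ l₂))
      (L∨′ cΔ₂ r₁ r₂)
      (shared-∨ (shared-mono (⊑-∷ˡ ∨₁) ⊑-refl sh₁) (shared-mono (⊑-∷ˡ ∨₂) ⊑-refl sh₂))
      (λ _ → or (cθ₁ cΔ₂) (cθ₂ cΔ₂))

  L∨₂ : Interpolation Γ₁ (φ ∷ Γ₂) Λ₁ Δ₂ → Interpolation Γ₁ (ψ ∷ Γ₂) Λ₁ Δ₂ →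
        Interpolation Γ₁ (φ ∨ ψ ∷ Γ₂) Λ₁ Δ₂
  L∨₂ (interpolation θ₁ w₁ l₁ r₁ sh₁ cθ₁) (interpolation θ₂ w₂ l₂ r₂ sh₂ cθ₂) =
    interpolation (θ₁ ∧ θ₂) (and w₁ w₂) (R∧′ cΛ₁ l₁ l₂)
      (swapˡ (L∨′ cΔ₂ (swapˡ (∧-elimˡ r₁)) (swapˡ (∧-elimʳ r₂))))
      (shared-∧ (shared-mono ⊑-refl (⊑-∷ˡ ∨₁) sh₁) (shared-mono ⊑-refl (⊑-∷ˡ ∨₂) sh₂))
      (λ c → and (cθ₁ c) (cθ₂ c))

L⩔₁ : ∀ χ {φL φR} →
      Interpolation (plug χ φL ∷ Γ₁) Γ₂ Λ₁ Δ₂ → Interpolation (plug χ φR ∷ Γ₁) Γ₂ Λ₁ Δ₂ →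
      Interpolation (plug χ (φL ⩔ φR) ∷ Γ₁) Γ₂ Λ₁ Δ₂
L⩔₁ {Δ₂ = Δ₂} χ (interpolation θ₁ w₁ l₁ r₁ sh₁ cθ₁) (interpolation θ₂ w₂ l₂ r₂ sh₂ cθ₂)
  with all? classical? Δ₂
... | yes cΔ₂ =
  interpolation (θ₁ ∨ θ₂) (or w₁ w₂) (L⩔ χ (∨-introˡ l₁) (∨-introʳ l₂)) (L∨′ cΔ₂ r₁ r₂)
    (shared-∨ (shared-mono (⊑-∷ˡ (Occ-plug χ ⩔₁)) ⊑-refl sh₁)
              (shared-mono (⊑-∷ˡ (Occ-plug χ ⩔₂)) ⊑-refl sh₂))
    (λ _ → or (cθ₁ cΔ₂) (cθ₂ cΔ₂))
... | no ¬cΔ₂ =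
  interpolation (θ₁ ⩔ θ₂) (ior w₁ w₂) (L⩔ χ (R⩔ˡ ∙ l₁) (R⩔ʳ ∙ l₂)) (L⩔ ∙ r₁ r₂)
    (shared-⩔ (shared-mono (⊑-∷ˡ (Occ-plug χ ⩔₁)) ⊑-refl sh₁)
              (shared-mono (⊑-∷ˡ (Occ-plug χ ⩔₂)) ⊑-refl sh₂))
    (⊥-elim ∘ ¬cΔ₂)

L⩔₂ : All Classical Λ₁ → ∀ χ {φL φR} →
      Interpolation Γ₁ (plug χ φL ∷ Γ₂) Λ₁ Δ₂ → Interpolation Γ₁ (plug χ φR ∷ Γ₂) Λ₁ Δ₂ →
      Interpolation Γ₁ (plug χ (φL ⩔ φR) ∷ Γ₂) Λ₁ Δ₂
L⩔₂ cΛ₁ χ (interpolation θ₁ w₁ l₁ r₁ sh₁ cθ₁) (interpolation θ₂ w₂ l₂ r₂ sh₂ cθ₂) =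
  interpolation (θ₁ ∧ θ₂) (and w₁ w₂) (R∧′ cΛ₁ l₁ l₂)
    (swapˡ (L⩔ χ (swapˡ (∧-elimˡ r₁)) (swapˡ (∧-elimʳ r₂))))
    (shared-∧ (shared-mono ⊑-refl (⊑-∷ˡ (Occ-plug χ ⩔₁)) sh₁)
              (shared-mono ⊑-refl (⊑-∷ˡ (Occ-plug χ ⩔₂)) sh₂))
    (λ c → and (cθ₁ c) (cθ₂ c))

Interpolates : List Fm → List Fm → Set
Interpolates Γ Δ = ∀ {Γ₁ Γ₂ Λ₁ Δ₂} → Γ ↭ Γ₁ ++ Γ₂ → Δ ↭ Λ₁ ++ Δ₂ → All Classical Λ₁ →
                   Interpolation Γ₁ Γ₂ Λ₁ Δ₂

interpolates-perm : Γ ↭ Γ' → Δ ↭ Δ' → Interpolates Γ Δ → Interpolates Γ' Δ'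
interpolates-perm p q ih pΓ pΔ = ih (trans p pΓ) (trans q pΔ)

interpolates-ax : ∀ p → Interpolates (var p ∷ Γ) (var p ∷ Δ)
interpolates-ax p {Γ₁} {Γ₂} {Λ₁} {Δ₂} pΓ pΔ _ with locate Γ₁ Γ₂ pΓ | locate Λ₁ Δ₂ pΔ
... | in₁ q₁ _ | in₁ q₂ _ = Interpolation-resp-↭ q₁ refl q₂ refl (interpolation-⊥ (ax p))
... | in₁ q₁ _ | in₂ q₂ _ = Interpolation-resp-↭ q₁ refl refl q₂ (ax₁₂ p)
... | in₂ q₁ _ | in₁ q₂ _ = Interpolation-resp-↭ refl q₁ q₂ refl (ax₂₁ p)
... | in₂ q₁ _ | in₂ q₂ _ = Interpolation-resp-↭ refl q₁ refl q₂ (interpolation-⊤ (ax p))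

interpolates-ax⊥ : Interpolates (⊥' ∷ Γ) Δ
interpolates-ax⊥ {Γ₁ = Γ₁} {Γ₂} pΓ _ _ with locate Γ₁ Γ₂ pΓ
... | in₁ q _ = Interpolation-resp-↭ q refl refl refl (interpolation-⊥ ax⊥)
... | in₂ q _ = Interpolation-resp-↭ refl q refl refl (interpolation-⊤ ax⊥)

interpolates-L¬ : Classical a → Interpolates Γ (a ∷ Δ) → Interpolates (¬' a ∷ Γ) Δ
interpolates-L¬ c ih {Γ₁} {Γ₂} pΓ pΔ cΛ₁ with locate Γ₁ Γ₂ pΓ
... | in₁ q pΓ' = Interpolation-resp-↭ q refl refl refl (L¬₁ c (ih pΓ' (prep _ pΔ) (c ∷ cΛ₁)))
... | in₂ q pΓ' = Interpolation-resp-↭ refl q refl refl (L¬₂ c (ih pΓ' (insert₂ [ _ ] pΔ) cΛ₁))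

interpolates-R¬ : Classical a → Interpolates (a ∷ Γ) Δ → Interpolates Γ (¬' a ∷ Δ)
interpolates-R¬ c ih {Λ₁ = Λ₁} {Δ₂} pΓ pΔ cΛ₁ with locate Λ₁ Δ₂ pΔ
... | in₁ q pΔ' = Interpolation-resp-↭ refl refl q refl
                    (R¬₁ c (ih (prep _ pΓ) pΔ' (All.tail (All-resp-↭ (↭-sym q) cΛ₁))))
... | in₂ q pΔ' = Interpolation-resp-↭ refl refl refl q (R¬₂ c (ih (insert₂ [ _ ] pΓ) pΔ' cΛ₁))

interpolates-L∧ : Interpolates (φ ∷ ψ ∷ Γ) Δ → Interpolates (φ ∧ ψ ∷ Γ) Δ
interpolates-L∧ ih {Γ₁} {Γ₂} pΓ pΔ cΛ₁ with locate Γ₁ Γ₂ pΓ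
... | in₁ q pΓ' = Interpolation-resp-↭ q refl refl refl (L∧₁ (ih (prep _ (prep _ pΓ')) pΔ cΛ₁))
... | in₂ q pΓ' = Interpolation-resp-↭ refl q refl refl (L∧₂ (ih (insert₂ (_ ∷ _ ∷ []) pΓ') pΔ cΛ₁))

interpolates-R∨ : Interpolates Γ (φ ∷ ψ ∷ Δ) → Interpolates Γ (φ ∨ ψ ∷ Δ)
interpolates-R∨ ih {Λ₁ = Λ₁} {Δ₂} pΓ pΔ cΛ₁ with locate Λ₁ Δ₂ pΔ
... | in₁ q pΔ' with or cφ cψ ∷ cΛ₁' ← All-resp-↭ (↭-sym q) cΛ₁ =
  Interpolation-resp-↭ refl refl q refl (R∨₁ (ih pΓ (prep _ (prep _ pΔ')) (cφ ∷ cψ ∷ cΛ₁')))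
... | in₂ q pΔ' = Interpolation-resp-↭ refl refl refl q (R∨₂ (ih pΓ (insert₂ (_ ∷ _ ∷ []) pΔ') cΛ₁))

interpolates-R∧ : All Classical Λ → Interpolates Γ (φ ∷ Λ) → Interpolates Γ (ψ ∷ Λ) →
                  Interpolates Γ (φ ∧ ψ ∷ Λ ++ Δ)
interpolates-R∧ {Λ = Λ} {φ = φ} {ψ = ψ} cΛ ih₁ ih₂ {Λ₁ = Λ₁} {Δ₂} pΓ pΔ cΛ₁ with locate Λ₁ Δ₂ pΔ
... | in₁ q pΔ'
  with and cφ cψ ∷ _ ← All-resp-↭ (↭-sym q) cΛ₁
  with refinement {ΛA} {ΛB} {ΔA} {ΔB} pΛ _ pΛ₁' pΔ₂ ← refine Λ _ Δ₂ pΔ'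
  with cΛA , cΛB ← All-++⁻-↭ ΛA pΛ cΛ =
  Interpolation-resp-↭ refl refl (trans (prep _ (↭-sym pΛ₁')) q) (↭-sym pΔ₂)
    (Interpolation-weaken ΔA ΔB
      (R∧₁ cΛA cΛB (ih₁ pΓ (prep φ pΛ) (cφ ∷ cΛA)) (ih₂ pΓ (prep ψ pΛ) (cψ ∷ cΛA))))
... | in₂ q pΔ'
  with refinement {ΛA} {ΛB} {ΔA} {ΔB} pΛ _ pΛ₁ pΔ₂' ← refine Λ Λ₁ _ pΔ'
  with cΛA , cΛB ← All-++⁻-↭ ΛA pΛ cΛ =
  Interpolation-resp-↭ refl refl (↭-sym pΛ₁) (trans (prep _ (↭-sym pΔ₂')) q)
    (Interpolation-weaken ΔA ΔB
      (R∧₂ cΛA cΛB (ih₁ pΓ (insert₂ [ φ ] pΛ) cΛA) (ih₂ pΓ (insert₂ [ ψ ] pΛ) cΛA)))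

interpolates-L∨ : All Classical Λ → Interpolates (φ ∷ Γ) Λ → Interpolates (ψ ∷ Γ) Λ →
                  Interpolates (φ ∨ ψ ∷ Γ) (Λ ++ Δ)
interpolates-L∨ {Λ = Λ} {φ = φ} {ψ = ψ} cΛ ih₁ ih₂ {Γ₁} {Γ₂} {Λ₁} {Δ₂} pΓ pΔ cΛ₁
  with refinement {ΛA} {ΛB} {ΔA} {ΔB} pΛ _ pΛ₁ pΔ₂ ← refine Λ Λ₁ Δ₂ pΔ
  with cΛA , cΛB ← All-++⁻-↭ ΛA pΛ cΛ
  with locate Γ₁ Γ₂ pΓ
... | in₁ q pΓ' =
  Interpolation-resp-↭ q refl (↭-sym pΛ₁) (↭-sym pΔ₂)
    (Interpolation-weaken ΔA ΔB
      (L∨₁ cΛA cΛB (ih₁ (prep φ pΓ') pΛ cΛA) (ih₂ (prep ψ pΓ') pΛ cΛA)))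
... | in₂ q pΓ' =
  Interpolation-resp-↭ refl q (↭-sym pΛ₁) (↭-sym pΔ₂)
    (Interpolation-weaken ΔA ΔB
      (L∨₂ cΛA cΛB (ih₁ (insert₂ [ φ ] pΓ') pΛ cΛA) (ih₂ (insert₂ [ ψ ] pΓ') pΛ cΛA)))

interpolates-L⩔ : ∀ χ {φL φR} → Interpolates (plug χ φL ∷ Γ) Δ → Interpolates (plug χ φR ∷ Γ) Δ →
                  Interpolates (plug χ (φL ⩔ φR) ∷ Γ) Δ
interpolates-L⩔ χ ih₁ ih₂ {Γ₁} {Γ₂} pΓ pΔ cΛ₁ with locate Γ₁ Γ₂ pΓ
... | in₁ q pΓ' = Interpolation-resp-↭ q refl refl refl
                    (L⩔₁ χ (ih₁ (prep _ pΓ') pΔ cΛ₁) (ih₂ (prep _ pΓ') pΔ cΛ₁))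
... | in₂ q pΓ' = Interpolation-resp-↭ refl q refl refl
                    (L⩔₂ cΛ₁ χ (ih₁ (insert₂ [ _ ] pΓ') pΔ cΛ₁) (ih₂ (insert₂ [ _ ] pΓ') pΔ cΛ₁))

interpolates-R⩔ˡ : ∀ χ {φL φR} → Interpolates Γ (plug χ φL ∷ Δ) →
                   Interpolates Γ (plug χ (φL ⩔ φR) ∷ Δ)
interpolates-R⩔ˡ χ ih {Λ₁ = Λ₁} {Δ₂} pΓ pΔ cΛ₁ with locate Λ₁ Δ₂ pΔ
... | in₁ q _   = ⊥-elim (plug-⩔-nonclassical χ (All.head (All-resp-↭ (↭-sym q) cΛ₁)))
... | in₂ q pΔ' = Interpolation-resp-↭ refl refl refl q (R⩔ˡ₂ χ (ih pΓ (insert₂ [ _ ] pΔ') cΛ₁))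

interpolates-R⩔ʳ : ∀ χ {φL φR} → Interpolates Γ (plug χ φR ∷ Δ) →
                   Interpolates Γ (plug χ (φL ⩔ φR) ∷ Δ)
interpolates-R⩔ʳ χ ih {Λ₁ = Λ₁} {Δ₂} pΓ pΔ cΛ₁ with locate Λ₁ Δ₂ pΔ
... | in₁ q _   = ⊥-elim (plug-⩔-nonclassical χ (All.head (All-resp-↭ (↭-sym q) cΛ₁)))
... | in₂ q pΔ' = Interpolation-resp-↭ refl refl refl q (R⩔ʳ₂ χ (ih pΓ (insert₂ [ _ ] pΔ') cΛ₁))

interpolates : GT⁻ ⊢ Γ ⇒ Δ → Interpolates Γ Δ
interpolates (perm p q d) = interpolates-perm p q (interpolates d)
interpolates (ax p)       = interpolates-ax p
interpolates ax⊥          = interpolates-ax⊥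
interpolates (L¬ c d)     = interpolates-L¬ c (interpolates d)
interpolates (R¬ c d)     = interpolates-R¬ c (interpolates d)
interpolates (L∧ d)       = interpolates-L∧ (interpolates d)
interpolates (R∧ c d e)   = interpolates-R∧ c (interpolates d) (interpolates e)
interpolates (L∨ c d e)   = interpolates-L∨ c (interpolates d) (interpolates e)
interpolates (R∨ d)       = interpolates-R∨ (interpolates d)
interpolates (L⩔ χ d e)   = interpolates-L⩔ χ (interpolates d) (interpolates e)
interpolates (R⩔ˡ χ d)    = interpolates-R⩔ˡ χ (interpolates d)
interpolates (R⩔ʳ χ d)    = interpolates-R⩔ʳ χ (interpolates d)
interpolates (cut () _ _)

-- Resolution semantics and soundness

Valuation : Set
Valuation = ℕ → Bool

infix 4 _⊨_ _⊨?_
_⊨_ : Valuation → Fm → Set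
v ⊨ var p = T (v p)
v ⊨ ⊥'    = ⊥
v ⊨ ¬' a  = ¬ (v ⊨ a)
v ⊨ a ∧ b = v ⊨ a × v ⊨ b
v ⊨ a ∨ b = v ⊨ a ⊎ v ⊨ b
v ⊨ a ⩔ b = v ⊨ a ⊎ v ⊨ b   -- reached only under ¬, i.e. outside well-formed formulas

_⊨?_ : ∀ v a → Dec (v ⊨ a)
v ⊨? var p = T? (v p)
v ⊨? ⊥'    = no id
v ⊨? ¬' a  = ¬? (v ⊨? a)
v ⊨? a ∧ b = (v ⊨? a) ×-dec (v ⊨? b)
v ⊨? a ∨ b = (v ⊨? a) ⊎-dec (v ⊨? b)
v ⊨? a ⩔ b = (v ⊨? a) ⊎-dec (v ⊨? b)

Entails : List Fm → List Fm → Set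
Entails Γ Δ = ∀ v → All (v ⊨_) Γ → Any (v ⊨_) Δ

Entails-resp-↭ : Γ ↭ Γ' → Δ ↭ Δ' → Entails Γ Δ → Entails Γ' Δ'
Entails-resp-↭ p q e v = Any-resp-↭ q ∘ e v ∘ All-resp-↭ (↭-sym p)

Entails-weakenʳ : ∀ Δ' → Entails Γ Δ → Entails Γ (Δ ++ Δ')
Entails-weakenʳ _ e v = AnyP.++⁺ˡ ∘ e v

Entails-cut : Entails Γ (φ ∷ Δ) → Entails (φ ∷ Π) Ξ → Entails (Π ++ Γ) (Δ ++ Ξ)
Entails-cut {Δ = Δ} {Π = Π} e₁ e₂ v πγ with π , γ ← AllP.++⁻ Π πγ with e₁ v γ
... | here t  = AnyP.++⁺ʳ Δ (e₂ v (t ∷ π))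
... | there d = AnyP.++⁺ˡ d

Entails-L¬ : Entails Γ (a ∷ Δ) → Entails (¬' a ∷ Γ) Δ
Entails-L¬ e v (¬t ∷ γ) with e v γ
... | here t  = ⊥-elim (¬t t)
... | there d = d

Entails-L¬⁻ : Entails (¬' a ∷ Γ) Δ → Entails Γ (a ∷ Δ)
Entails-L¬⁻ {a = a} e v γ with v ⊨? a
... | yes t = here t
... | no ¬t = there (e v (¬t ∷ γ))

Entails-R¬ : Entails (a ∷ Γ) Δ → Entails Γ (¬' a ∷ Δ)
Entails-R¬ {a = a} e v γ with v ⊨? a
... | yes t = there (e v (t ∷ γ))
... | no ¬t = here ¬t

Entails-R¬⁻ : Entails Γ (¬' a ∷ Δ) → Entails (a ∷ Γ) Δ
Entails-R¬⁻ e v (t ∷ γ) with e v γ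
... | here ¬t = ⊥-elim (¬t t)
... | there d = d

Entails-L∧ : Entails (a ∷ b ∷ Γ) Δ → Entails (a ∧ b ∷ Γ) Δ
Entails-L∧ e v ((x , y) ∷ γ) = e v (x ∷ y ∷ γ)

Entails-L∧⁻ : Entails (a ∧ b ∷ Γ) Δ → Entails (a ∷ b ∷ Γ) Δ
Entails-L∧⁻ e v (x ∷ y ∷ γ) = e v ((x , y) ∷ γ)

Entails-R∧ : Entails Γ (a ∷ Δ) → Entails Γ (b ∷ Δ) → Entails Γ (a ∧ b ∷ Δ)
Entails-R∧ e₁ e₂ v γ with e₁ v γ | e₂ v γ
... | here x  | here y  = here (x , y)
... | there d | _       = there d
... | _       | there d = there d

Entails-R∧⁻ : Entails Γ (a ∧ b ∷ Δ) → Entails Γ (a ∷ Δ) × Entails Γ (b ∷ Δ)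
Entails-R∧⁻ e = (λ v → head-map proj₁ ∘ e v) , (λ v → head-map proj₂ ∘ e v)
  where
    head-map : ∀ {v} → (v ⊨ a ∧ b → v ⊨ φ) → Any (v ⊨_) (a ∧ b ∷ Δ) → Any (v ⊨_) (φ ∷ Δ)
    head-map f (here x)  = here (f x)
    head-map f (there d) = there d

Entails-L∨ : Entails (a ∷ Γ) Δ → Entails (b ∷ Γ) Δ → Entails (a ∨ b ∷ Γ) Δ
Entails-L∨ e₁ e₂ v (inj₁ x ∷ γ) = e₁ v (x ∷ γ)
Entails-L∨ e₁ e₂ v (inj₂ y ∷ γ) = e₂ v (y ∷ γ)

Entails-L∨⁻ : Entails (a ∨ b ∷ Γ) Δ → Entails (a ∷ Γ) Δ × Entails (b ∷ Γ) Δ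
Entails-L∨⁻ e = (λ { v (x ∷ γ) → e v (inj₁ x ∷ γ) }) , (λ { v (y ∷ γ) → e v (inj₂ y ∷ γ) })

Entails-R∨ : Entails Γ (a ∷ b ∷ Δ) → Entails Γ (a ∨ b ∷ Δ)
Entails-R∨ e v γ with e v γ
... | here x          = here (inj₁ x)
... | there (here y)  = here (inj₂ y)
... | there (there d) = there d

Entails-R∨⁻ : Entails Γ (a ∨ b ∷ Δ) → Entails Γ (a ∷ b ∷ Δ)
Entails-R∨⁻ e v γ with e v γ
... | here (inj₁ x) = here x
... | here (inj₂ y) = there (here y)
... | there d       = there (there d)

Entails-R⊥⁻ : Entails Γ (⊥' ∷ Δ) → Entails Γ Δ
Entails-R⊥⁻ e v γ with e v γ
... | there d = d

data Resolution : Fm → Fm → Set where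
  var  : ∀ p → Resolution (var p) (var p)
  bot  : Resolution ⊥' ⊥'
  neg  : ∀ a → Resolution (¬' a) (¬' a)
  and  : ∀ {a b α β} → Resolution a α → Resolution b β → Resolution (a ∧ b) (α ∧ β)
  or   : ∀ {a b α β} → Resolution a α → Resolution b β → Resolution (a ∨ b) (α ∨ β)
  ior₁ : ∀ {a b α} → Resolution a α → Resolution (a ⩔ b) α
  ior₂ : ∀ {a b β} → Resolution b β → Resolution (a ⩔ b) β

Resolutions : List Fm → List Fm → Set
Resolutions = Pointwise Resolution

resolution : ∀ φ → ∃ (Resolution φ)
resolution (var p) = _ , var p
resolution ⊥'      = _ , bot
resolution (¬' a)  = _ , neg a
resolution (a ∧ b) = _ , and (proj₂ (resolution a)) (proj₂ (resolution b))
resolution (a ∨ b) = _ , or (proj₂ (resolution a)) (proj₂ (resolution b))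
resolution (a ⩔ b) = _ , ior₁ (proj₂ (resolution a))

resolutions : ∀ Δ → ∃ (Resolutions Δ)
resolutions []      = _ , []
resolutions (δ ∷ Δ) = _ , proj₂ (resolution δ) ∷ proj₂ (resolutions Δ)

Resolution-self : Classical a → Resolution a a
Resolution-self (var p)   = var p
Resolution-self bot       = bot
Resolution-self (neg {a} _) = neg a
Resolution-self (and c d) = and (Resolution-self c) (Resolution-self d)
Resolution-self (or c d)  = or (Resolution-self c) (Resolution-self d)

Resolution-classical : ∀ {α} → Classical a → Resolution a α → α ≡ a
Resolution-classical (var p)   (var p)   = refl
Resolution-classical bot       bot       = refl
Resolution-classical (neg _)   (neg _)   = refl
Resolution-classical (and c d) (and r s) =
  cong₂ _∧_ (Resolution-classical c r) (Resolution-classical d s)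
Resolution-classical (or c d)  (or r s)  =
  cong₂ _∨_ (Resolution-classical c r) (Resolution-classical d s)

Resolutions-classical : ∀ {Λ'} → All Classical Λ → Resolutions Λ Λ' → Λ' ≡ Λ
Resolutions-classical []       []       = refl
Resolutions-classical (c ∷ cs) (r ∷ rs) =
  cong₂ _∷_ (Resolution-classical c r) (Resolutions-classical cs rs)

Resolution-WF : ∀ {α} → WF φ → Resolution φ α → Classical α
Resolution-WF (cl c)    r          = subst Classical (sym (Resolution-classical c r)) c
Resolution-WF (and w v) (and r s) = and (Resolution-WF w r) (Resolution-WF v s)
Resolution-WF (or w v)  (or r s)  = or (Resolution-WF w r) (Resolution-WF v s)
Resolution-WF (ior w _) (ior₁ r)  = Resolution-WF w r
Resolution-WF (ior _ v) (ior₂ s)  = Resolution-WF v s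

Resolutions-WF : All WF Γ → Resolutions Γ Γ' → All Classical Γ'
Resolutions-WF []       []       = []
Resolutions-WF (w ∷ ws) (r ∷ rs) = Resolution-WF w r ∷ Resolutions-WF ws rs

Resolution-plug : ∀ χ {η η' α} → (∀ {β} → Resolution η β → Resolution η' β) →
                  Resolution (plug χ η) α → Resolution (plug χ η') α
Resolution-plug ∙        f r          = f r
Resolution-plug (∧ˡ χ _) f (and r s) = and (Resolution-plug χ f r) s
Resolution-plug (∧ʳ _ χ) f (and r s) = and r (Resolution-plug χ f s)
Resolution-plug (∨ˡ χ _) f (or r s)  = or (Resolution-plug χ f r) s
Resolution-plug (∨ʳ _ χ) f (or r s)  = or r (Resolution-plug χ f s)
Resolution-plug (⩔ˡ χ _) f (ior₁ r)  = ior₁ (Resolution-plug χ f r)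
Resolution-plug (⩔ˡ χ _) f (ior₂ s)  = ior₂ s
Resolution-plug (⩔ʳ _ χ) f (ior₁ r)  = ior₁ r
Resolution-plug (⩔ʳ _ χ) f (ior₂ s)  = ior₂ (Resolution-plug χ f s)

Resolution-plug-⩔⁻ : ∀ χ {φL φR α} → Resolution (plug χ (φL ⩔ φR)) α →
                     Resolution (plug χ φL) α ⊎ Resolution (plug χ φR) α
Resolution-plug-⩔⁻ ∙        (ior₁ r)  = inj₁ r
Resolution-plug-⩔⁻ ∙        (ior₂ s)  = inj₂ s
Resolution-plug-⩔⁻ (∧ˡ χ _) (and r s) =
  Sum.map (λ r → and r s) (λ r → and r s) (Resolution-plug-⩔⁻ χ r)
Resolution-plug-⩔⁻ (∧ʳ _ χ) (and r s) = Sum.map (and r) (and r) (Resolution-plug-⩔⁻ χ s)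
Resolution-plug-⩔⁻ (∨ˡ χ _) (or r s)  =
  Sum.map (λ r → or r s) (λ r → or r s) (Resolution-plug-⩔⁻ χ r)
Resolution-plug-⩔⁻ (∨ʳ _ χ) (or r s)  = Sum.map (or r) (or r) (Resolution-plug-⩔⁻ χ s)
Resolution-plug-⩔⁻ (⩔ˡ χ _) (ior₁ r)  = Sum.map ior₁ ior₁ (Resolution-plug-⩔⁻ χ r)
Resolution-plug-⩔⁻ (⩔ˡ χ _) (ior₂ s)  = inj₁ (ior₂ s)
Resolution-plug-⩔⁻ (⩔ʳ _ χ) (ior₁ r)  = inj₁ (ior₁ r)
Resolution-plug-⩔⁻ (⩔ʳ _ χ) (ior₂ s)  = Sum.map ior₂ ior₂ (Resolution-plug-⩔⁻ χ s)

Valid : List Fm → List Fm → Set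
Valid Γ Δ = ∀ {Γ'} → Resolutions Γ Γ' → ∃[ Δ' ] Resolutions Δ Δ' × Entails Γ' Δ'

valid-perm : Γ ↭ Γ' → Δ ↭ Δ' → Valid Γ Δ → Valid Γ' Δ'
valid-perm p q V rΓ'
  with _ , rΓ , Γ'↭ ← Pointwise-↭ (↭-sym p) rΓ'
  with _ , rΔ , e ← V rΓ
  with _ , rΔ' , Δ↭ ← Pointwise-↭ q rΔ =
  _ , rΔ' , Entails-resp-↭ (↭-sym Γ'↭) Δ↭ e

valid-ax : ∀ p → Valid (var p ∷ Γ) (var p ∷ Δ)
valid-ax {Δ = Δ} p (var _ ∷ _) = _ , var p ∷ proj₂ (resolutions Δ) , λ { _ (t ∷ _) → here t }

valid-ax⊥ : Valid (⊥' ∷ Γ) Δ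
valid-ax⊥ {Δ = Δ} (bot ∷ _) = _ , proj₂ (resolutions Δ) , λ { _ (() ∷ _) }

valid-L¬ : Classical a → Valid Γ (a ∷ Δ) → Valid (¬' a ∷ Γ) Δ
valid-L¬ c V (neg _ ∷ rΓ) with _ , r ∷ rΔ , e ← V rΓ with refl ← Resolution-classical c r =
  _ , rΔ , Entails-L¬ e

valid-R¬ : Classical a → Valid (a ∷ Γ) Δ → Valid Γ (¬' a ∷ Δ)
valid-R¬ {a = a} c V rΓ with _ , rΔ , e ← V (Resolution-self c ∷ rΓ) = _ , neg a ∷ rΔ , Entails-R¬ e

valid-L∧ : Valid (φ ∷ ψ ∷ Γ) Δ → Valid (φ ∧ ψ ∷ Γ) Δ
valid-L∧ V (and r s ∷ rΓ) with _ , rΔ , e ← V (r ∷ s ∷ rΓ) = _ , rΔ , Entails-L∧ e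

valid-R∧ : All Classical Λ → Valid Γ (φ ∷ Λ) → Valid Γ (ψ ∷ Λ) → Valid Γ (φ ∧ ψ ∷ Λ ++ Δ)
valid-R∧ {Δ = Δ} cΛ V₁ V₂ rΓ
  with _ , r₁ ∷ rΛ , e₁ ← V₁ rΓ | _ , r₂ ∷ rΛ' , e₂ ← V₂ rΓ
  with refl ← Resolutions-classical cΛ rΛ | refl ← Resolutions-classical cΛ rΛ' =
  _ , and r₁ r₂ ∷ Pointwise.++⁺ rΛ (proj₂ (resolutions Δ)) , Entails-weakenʳ _ (Entails-R∧ e₁ e₂)

valid-L∨ : All Classical Λ → Valid (φ ∷ Γ) Λ → Valid (ψ ∷ Γ) Λ → Valid (φ ∨ ψ ∷ Γ) (Λ ++ Δ)
valid-L∨ {Δ = Δ} cΛ V₁ V₂ (or r s ∷ rΓ)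
  with _ , rΛ , e₁ ← V₁ (r ∷ rΓ) | _ , rΛ' , e₂ ← V₂ (s ∷ rΓ)
  with refl ← Resolutions-classical cΛ rΛ | refl ← Resolutions-classical cΛ rΛ' =
  _ , Pointwise.++⁺ rΛ (proj₂ (resolutions Δ)) , Entails-weakenʳ _ (Entails-L∨ e₁ e₂)

valid-R∨ : Valid Γ (φ ∷ ψ ∷ Δ) → Valid Γ (φ ∨ ψ ∷ Δ)
valid-R∨ V rΓ with _ , r ∷ s ∷ rΔ , e ← V rΓ = _ , or r s ∷ rΔ , Entails-R∨ e

valid-L⩔ : ∀ χ {φL φR} → Valid (plug χ φL ∷ Γ) Δ → Valid (plug χ φR ∷ Γ) Δ →
           Valid (plug χ (φL ⩔ φR) ∷ Γ) Δ
valid-L⩔ χ V₁ V₂ (r ∷ rΓ) =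
  Sum.[ (λ r → V₁ (r ∷ rΓ)) , (λ r → V₂ (r ∷ rΓ)) ] (Resolution-plug-⩔⁻ χ r)

valid-R-plug : ∀ χ {η η'} → (∀ {β} → Resolution η β → Resolution η' β) →
               Valid Γ (plug χ η ∷ Δ) → Valid Γ (plug χ η' ∷ Δ)
valid-R-plug χ f V rΓ with _ , r ∷ rΔ , e ← V rΓ = _ , Resolution-plug χ f r ∷ rΔ , e

valid-cut : Valid Γ (φ ∷ Δ) → Valid (φ ∷ Π) Ξ → Valid (Π ++ Γ) (Δ ++ Ξ)
valid-cut {Π = Π} V₁ V₂ rΠΓ
  with _ , _ , refl , rΠ , rΓ ← Pointwise-++⁻ Π rΠΓ
  with _ , r ∷ rΔ , e₁ ← V₁ rΓ
  with _ , rΞ , e₂ ← V₂ (r ∷ rΠ) =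
  _ , Pointwise.++⁺ rΔ rΞ , Entails-cut e₁ e₂

sound : S ⊢ Γ ⇒ Δ → Valid Γ Δ
sound (perm p q d) = valid-perm p q (sound d)
sound (ax p)       = valid-ax p
sound ax⊥          = valid-ax⊥
sound (L¬ c d)     = valid-L¬ c (sound d)
sound (R¬ c d)     = valid-R¬ c (sound d)
sound (L∧ d)       = valid-L∧ (sound d)
sound (R∧ c d e)   = valid-R∧ c (sound d) (sound e)
sound (L∨ c d e)   = valid-L∨ c (sound d) (sound e)
sound (R∨ d)       = valid-R∨ (sound d)
sound (L⩔ χ d e)   = valid-L⩔ χ (sound d) (sound e)
sound (R⩔ˡ χ d)    = valid-R-plug χ ior₁ (sound d)
sound (R⩔ʳ χ d)    = valid-R-plug χ ior₂ (sound d)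
sound (cut _ d e)  = valid-cut (sound d) (sound e)

-- Completeness of GT⁻ and cut elimination

indicator : List ℕ → Valuation
indicator P q = ⌊ q ∈? P ⌋

complete-atomic : ∀ P Q → Entails (map var P) (map var Q) → GT⁻ ⊢ map var P ⇒ map var Q
complete-atomic P Q e
  with q , q∈Q , t ← find (AnyP.map⁻ (e (indicator P) (AllP.map⁺ (All.tabulate fromWitness))))
  with _ , P↭ ← ∈⇒↭∷ (∈-map⁺ var (toWitness {a? = q ∈? P} t))
  with _ , Q↭ ← ∈⇒↭∷ (∈-map⁺ var q∈Q) =
  perm (↭-sym P↭) (↭-sym Q↭) (ax q)

data Side : Set where
  ante succ : Side

Signed : Set
Signed = Side × Fm

antecedent : List Signed → List Fm
antecedent []               = []
antecedent ((ante , a) ∷ Φ) = a ∷ antecedent Φ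
antecedent ((succ , _) ∷ Φ) = antecedent Φ

succedent : List Signed → List Fm
succedent []               = []
succedent ((ante , _) ∷ Φ) = succedent Φ
succedent ((succ , a) ∷ Φ) = a ∷ succedent Φ

-- The size of a plus k; accumulating makes the weight drop definitionally at non-branching steps.
addSize : Fm → ℕ → ℕ
addSize (var _) k = suc k
addSize ⊥'      k = suc k
addSize (¬' a)  k = suc (addSize a k)
addSize (a ∧ b) k = suc (addSize a (addSize b k))
addSize (a ∨ b) k = suc (addSize a (addSize b k))
addSize (a ⩔ b) k = suc (addSize a (addSize b k))

weight : List Signed → ℕ
weight []            = 0
weight ((_ , a) ∷ Φ) = addSize a (weight Φ)

≤-addSize : ∀ a {k} → k ≤ addSize a k
≤-addSize (var _) = m≤n⇒m≤1+n ≤-refl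
≤-addSize ⊥'      = m≤n⇒m≤1+n ≤-refl
≤-addSize (¬' a)  = m≤n⇒m≤1+n (≤-addSize a)
≤-addSize (a ∧ b) = m≤n⇒m≤1+n (≤-trans (≤-addSize b) (≤-addSize a))
≤-addSize (a ∨ b) = m≤n⇒m≤1+n (≤-trans (≤-addSize b) (≤-addSize a))
≤-addSize (a ⩔ b) = m≤n⇒m≤1+n (≤-trans (≤-addSize b) (≤-addSize a))

addSize-mono : ∀ a {k k'} → k ≤ k' → addSize a k ≤ addSize a k'
addSize-mono (var _) k≤k' = s≤s k≤k'
addSize-mono ⊥'      k≤k' = s≤s k≤k'
addSize-mono (¬' a)  k≤k' = s≤s (addSize-mono a k≤k')
addSize-mono (a ∧ b) k≤k' = s≤s (addSize-mono a (addSize-mono b k≤k'))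
addSize-mono (a ∨ b) k≤k' = s≤s (addSize-mono a (addSize-mono b k≤k'))
addSize-mono (a ⩔ b) k≤k' = s≤s (addSize-mono a (addSize-mono b k≤k'))

module _ {k n} (a b : Fm) (lt : addSize a (addSize b k) < n) where

  addSize-dropʳ : addSize a k < n
  addSize-dropʳ = ≤-trans (s≤s (addSize-mono a (≤-addSize b))) lt

  addSize-dropˡ : addSize b k < n
  addSize-dropˡ = ≤-trans (s≤s (≤-addSize a)) lt

succedent-classical : ∀ {Φ} Q → All (Classical ∘ proj₂) Φ → All Classical (succedent Φ ++ map var Q)
succedent-classical {[]}             Q []       = AllP.map⁺ (All.universal var Q)
succedent-classical {(ante , _) ∷ Φ} Q (_ ∷ cΦ) = succedent-classical Q cΦ
succedent-classical {(succ , _) ∷ Φ} Q (c ∷ cΦ) = c ∷ succedent-classical Q cΦ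

-- Invertible proof search: Φ lists the formulas not yet decomposed, P and Q the variables reached.
complete-signed : ∀ n Φ {P Q} → weight Φ < n → All (Classical ∘ proj₂) Φ →
                  Entails (antecedent Φ ++ map var P) (succedent Φ ++ map var Q) →
                  GT⁻ ⊢ antecedent Φ ++ map var P ⇒ succedent Φ ++ map var Q
complete-signed n [] {P} {Q} _ _ e = complete-atomic P Q e
complete-signed zero (_ ∷ _) ()
complete-signed (suc n) ((ante , var p) ∷ Φ) {P} (s≤s lt) (_ ∷ cΦ) e =
  perm (shift (var p) (antecedent Φ) (map var P)) refl
    (complete-signed n Φ lt cΦ (Entails-resp-↭ (↭-sym (shift _ _ _)) refl e))
complete-signed (suc n) ((ante , ⊥') ∷ Φ) _ _ _ = ax⊥
complete-signed (suc n) ((ante , ¬' a) ∷ Φ) (s≤s lt) (neg c ∷ cΦ) e =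
  L¬ c (complete-signed n ((succ , a) ∷ Φ) lt (c ∷ cΦ) (Entails-L¬⁻ e))
complete-signed (suc n) ((ante , a ∧ b) ∷ Φ) (s≤s lt) (and c d ∷ cΦ) e =
  L∧ (complete-signed n ((ante , a) ∷ (ante , b) ∷ Φ) lt (c ∷ d ∷ cΦ) (Entails-L∧⁻ e))
complete-signed (suc n) ((ante , a ∨ b) ∷ Φ) {Q = Q} (s≤s lt) (or c d ∷ cΦ) e =
  L∨′ (succedent-classical Q cΦ)
    (complete-signed n ((ante , a) ∷ Φ) (addSize-dropʳ a b lt) (c ∷ cΦ) (proj₁ (Entails-L∨⁻ e)))
    (complete-signed n ((ante , b) ∷ Φ) (addSize-dropˡ a b lt) (d ∷ cΦ) (proj₂ (Entails-L∨⁻ e)))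
complete-signed (suc n) ((succ , var p) ∷ Φ) {Q = Q} (s≤s lt) (_ ∷ cΦ) e =
  perm refl (shift (var p) (succedent Φ) (map var Q))
    (complete-signed n Φ lt cΦ (Entails-resp-↭ refl (↭-sym (shift _ _ _)) e))
complete-signed (suc n) ((succ , ⊥') ∷ Φ) (s≤s lt) (_ ∷ cΦ) e =
  weaken-headʳ ⊥' (complete-signed n Φ lt cΦ (Entails-R⊥⁻ e))
complete-signed (suc n) ((succ , ¬' a) ∷ Φ) (s≤s lt) (neg c ∷ cΦ) e =
  R¬ c (complete-signed n ((ante , a) ∷ Φ) lt (c ∷ cΦ) (Entails-R¬⁻ e))
complete-signed (suc n) ((succ , a ∧ b) ∷ Φ) {Q = Q} (s≤s lt) (and c d ∷ cΦ) e =
  R∧′ (succedent-classical Q cΦ)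
    (complete-signed n ((succ , a) ∷ Φ) (addSize-dropʳ a b lt) (c ∷ cΦ) (proj₁ (Entails-R∧⁻ e)))
    (complete-signed n ((succ , b) ∷ Φ) (addSize-dropˡ a b lt) (d ∷ cΦ) (proj₂ (Entails-R∧⁻ e)))
complete-signed (suc n) ((succ , a ∨ b) ∷ Φ) (s≤s lt) (or c d ∷ cΦ) e =
  R∨ (complete-signed n ((succ , a) ∷ (succ , b) ∷ Φ) lt (c ∷ d ∷ cΦ) (Entails-R∨⁻ e))

signed : List Fm → List Fm → List Signed
signed Γ Δ = map (ante ,_) Γ ++ map (succ ,_) Δ

antecedent-signed : ∀ Γ Δ → antecedent (signed Γ Δ) ++ [] ≡ Γ
antecedent-signed []      []      = refl
antecedent-signed []      (_ ∷ Δ) = antecedent-signed [] Δ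
antecedent-signed (γ ∷ Γ) Δ       = cong (γ ∷_) (antecedent-signed Γ Δ)

succedent-signed : ∀ Γ Δ → succedent (signed Γ Δ) ++ [] ≡ Δ
succedent-signed []      []      = refl
succedent-signed []      (δ ∷ Δ) = cong (δ ∷_) (succedent-signed [] Δ)
succedent-signed (_ ∷ Γ) Δ       = succedent-signed Γ Δ

complete-classical : All Classical Γ → All Classical Δ → Entails Γ Δ → GT⁻ ⊢ Γ ⇒ Δ
complete-classical {Γ} {Δ} cΓ cΔ e =
  subst₂ (GT⁻ ⊢_⇒_) (antecedent-signed Γ Δ) (succedent-signed Γ Δ)
    (complete-signed _ (signed Γ Δ) ≤-refl (AllP.++⁺ (AllP.map⁺ cΓ) (AllP.map⁺ cΔ))
      (subst₂ Entails (sym (antecedent-signed Γ Δ)) (sym (succedent-signed Γ Δ)) e))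

infixl 5 _▷_
_▷_ : Ctx → Ctx → Ctx
∙        ▷ ξ = ξ
(∧ˡ χ b) ▷ ξ = ∧ˡ (χ ▷ ξ) b
(∧ʳ a χ) ▷ ξ = ∧ʳ a (χ ▷ ξ)
(∨ˡ χ b) ▷ ξ = ∨ˡ (χ ▷ ξ) b
(∨ʳ a χ) ▷ ξ = ∨ʳ a (χ ▷ ξ)
(⩔ˡ χ b) ▷ ξ = ⩔ˡ (χ ▷ ξ) b
(⩔ʳ a χ) ▷ ξ = ⩔ʳ a (χ ▷ ξ)

plug-▷ : ∀ χ ξ η → plug (χ ▷ ξ) η ≡ plug χ (plug ξ η)
plug-▷ ∙        ξ η = refl
plug-▷ (∧ˡ χ b) ξ η = cong (_∧ b) (plug-▷ χ ξ η)
plug-▷ (∧ʳ a χ) ξ η = cong (a ∧_) (plug-▷ χ ξ η)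
plug-▷ (∨ˡ χ b) ξ η = cong (_∨ b) (plug-▷ χ ξ η)
plug-▷ (∨ʳ a χ) ξ η = cong (a ∨_) (plug-▷ χ ξ η)
plug-▷ (⩔ˡ χ b) ξ η = cong (_⩔ b) (plug-▷ χ ξ η)
plug-▷ (⩔ʳ a χ) ξ η = cong (a ⩔_) (plug-▷ χ ξ η)

module _ (χ ξ : Ctx) {η : Fm} where

  nestˡ : S ⊢ plug χ (plug ξ η) ∷ Γ ⇒ Δ → S ⊢ plug (χ ▷ ξ) η ∷ Γ ⇒ Δ
  nestˡ = subst (λ θ → _ ⊢ θ ∷ _ ⇒ _) (sym (plug-▷ χ ξ η))

  unnestˡ : S ⊢ plug (χ ▷ ξ) η ∷ Γ ⇒ Δ → S ⊢ plug χ (plug ξ η) ∷ Γ ⇒ Δ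
  unnestˡ = subst (λ θ → _ ⊢ θ ∷ _ ⇒ _) (plug-▷ χ ξ η)

  nestʳ : S ⊢ Γ ⇒ plug χ (plug ξ η) ∷ Δ → S ⊢ Γ ⇒ plug (χ ▷ ξ) η ∷ Δ
  nestʳ = subst (λ θ → _ ⊢ _ ⇒ θ ∷ _) (sym (plug-▷ χ ξ η))

  unnestʳ : S ⊢ Γ ⇒ plug (χ ▷ ξ) η ∷ Δ → S ⊢ Γ ⇒ plug χ (plug ξ η) ∷ Δ
  unnestʳ = subst (λ θ → _ ⊢ _ ⇒ θ ∷ _) (plug-▷ χ ξ η)

resolve-antecedent : ∀ χ γ → (∀ {γ'} → Resolution γ γ' → S ⊢ plug χ γ' ∷ Γ ⇒ Δ) →
                     S ⊢ plug χ γ ∷ Γ ⇒ Δ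
resolve-antecedent χ (var p) k = k (var p)
resolve-antecedent χ ⊥'      k = k bot
resolve-antecedent χ (¬' a)  k = k (neg a)
resolve-antecedent χ (a ∧ b) k =
  unnestˡ χ (∧ˡ ∙ b) (resolve-antecedent (χ ▷ ∧ˡ ∙ b) a λ {α} r →
    nestˡ χ (∧ˡ ∙ b) (unnestˡ χ (∧ʳ α ∙) (resolve-antecedent (χ ▷ ∧ʳ α ∙) b λ s →
      nestˡ χ (∧ʳ α ∙) (k (and r s)))))
resolve-antecedent χ (a ∨ b) k =
  unnestˡ χ (∨ˡ ∙ b) (resolve-antecedent (χ ▷ ∨ˡ ∙ b) a λ {α} r →
    nestˡ χ (∨ˡ ∙ b) (unnestˡ χ (∨ʳ α ∙) (resolve-antecedent (χ ▷ ∨ʳ α ∙) b λ s →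
      nestˡ χ (∨ʳ α ∙) (k (or r s)))))
resolve-antecedent χ (a ⩔ b) k =
  L⩔ χ (resolve-antecedent χ a (k ∘ ior₁)) (resolve-antecedent χ b (k ∘ ior₂))

resolve-succedent : ∀ χ {δ δ'} → Resolution δ δ' → S ⊢ Γ ⇒ plug χ δ' ∷ Δ → S ⊢ Γ ⇒ plug χ δ ∷ Δ
resolve-succedent χ (var p) d = d
resolve-succedent χ bot     d = d
resolve-succedent χ (neg a) d = d
resolve-succedent χ (and {b = b} {α = α} r s) d =
  unnestʳ χ (∧ˡ ∙ b) (resolve-succedent (χ ▷ ∧ˡ ∙ b) r
    (nestʳ χ (∧ˡ ∙ b) (unnestʳ χ (∧ʳ α ∙) (resolve-succedent (χ ▷ ∧ʳ α ∙) s (nestʳ χ (∧ʳ α ∙) d)))))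
resolve-succedent χ (or {b = b} {α = α} r s) d =
  unnestʳ χ (∨ˡ ∙ b) (resolve-succedent (χ ▷ ∨ˡ ∙ b) r
    (nestʳ χ (∨ˡ ∙ b) (unnestʳ χ (∨ʳ α ∙) (resolve-succedent (χ ▷ ∨ʳ α ∙) s (nestʳ χ (∨ʳ α ∙) d)))))
resolve-succedent χ (ior₁ r) d = R⩔ˡ χ (resolve-succedent χ r d)
resolve-succedent χ (ior₂ s) d = R⩔ʳ χ (resolve-succedent χ s d)

resolve-antecedents : ∀ Γ → (∀ {Γ'} → Resolutions Γ Γ' → S ⊢ Γ' ++ Π ⇒ Δ) → S ⊢ Γ ++ Π ⇒ Δ
resolve-antecedents []                k = k []
resolve-antecedents {Π = Π} (γ ∷ Γ) k =
  resolve-antecedent ∙ γ λ {γ'} r → perm (shift γ' Γ Π) refl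
    (resolve-antecedents Γ λ {Γ'} rs → perm (↭-sym (shift γ' Γ' Π)) refl (k (r ∷ rs)))

resolve-succedents : Resolutions Δ Δ' → S ⊢ Γ ⇒ Δ' ++ Ξ → S ⊢ Γ ⇒ Δ ++ Ξ
resolve-succedents []                                              d = d
resolve-succedents {Δ = δ ∷ Δ} {Δ' = _ ∷ Δ'} {Ξ = Ξ} (r ∷ rs) d =
  perm refl (shift δ Δ Ξ)
    (resolve-succedents rs (perm refl (↭-sym (shift δ Δ' Ξ)) (resolve-succedent ∙ r d)))

complete : All WF Γ → All WF Δ → Valid Γ Δ → GT⁻ ⊢ Γ ⇒ Δ
complete {Γ} {Δ} wΓ wΔ V =
  subst₂ (GT⁻ ⊢_⇒_) (++-identityʳ Γ) (++-identityʳ Δ) (resolve-antecedents Γ λ rΓ →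
    let _ , rΔ , e = V rΓ in
    resolve-succedents rΔ (subst₂ (GT⁻ ⊢_⇒_) (sym (++-identityʳ _)) (sym (++-identityʳ _))
      (complete-classical (Resolutions-WF wΓ rΓ) (Resolutions-WF wΔ rΔ) e)))

cut-elimination : All WF Γ → All WF Δ → GT ⊢ Γ ⇒ Δ → GT⁻ ⊢ Γ ⇒ Δ
cut-elimination wΓ wΔ = complete wΓ wΔ ∘ sound

mainTheorem11 : ∀ (Γ Δ : List Fm) → All WF Γ → All WF Δ → GT ⊢ Γ ⇒ Δ →
    ∀ (Γ₁ Γ₂ Λ₁ Δ₂ : List Fm) → Γ ↭ Γ₁ ++ Γ₂ → Δ ↭ Λ₁ ++ Δ₂ → All Classical Λ₁ →
    Σ Fm (λ φ → WF φ × Interpolant Γ₁ Γ₂ Λ₁ Δ₂ φ × (All Classical Δ₂ → Classical φ))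
mainTheorem11 Γ Δ wΓ wΔ d Γ₁ Γ₂ Λ₁ Δ₂ pΓ pΔ cΛ₁ =
  θ , wf , record { left = perm refl (++-comm [ θ ] Λ₁) left ; right = right ; vars = shared } ,
  classical
  where open Interpolation (interpolates (cut-elimination wΓ wΔ d) {Γ₁} {Γ₂} {Λ₁} {Δ₂} pΓ pΔ cΛ₁)
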